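{- For each $k\in\mathbb N$, $\mathcal N[\mathcal{IS}_{br}/O(n^k)]\subsetneq\mathcal N[\mathcal{IS}_{br}/O(n^{k^2+3})]$.
   Context: Let $\mathbb B=\{\mathsf T,\mathsf F\}$. There are Boolean registers named $\mathtt{in}{:}i$, $\mathtt{aux}{:}i$ ($i\ge1$) and $\mathtt{out}$, processing methods $\mathtt{set{:}T}$ (content becomes $\mathsf T$, reply $\mathsf T$), $\mathtt{set{:}F}$ (content becomes $\mathsf F$, reply $\mathsf F$), $\mathtt{get}$ (no change, reply is the content). Basic instructions are $f.m$. Primitive instructions: for each basic instruction $a$, the plain instruction $a$, positive test $+a$, negative test $-a$; forward jumps $\#l$ ($l\in\mathbb N$); termination $!$. An instruction sequence is a finite non-empty sequence $X=u_1;\dots;u_k$ of primitive instructions, $|X|=k$. Execution starts at $u_1$: $a$ executes $a$ and proceeds with the next instruction; $+a$ executes $a$ and proceeds with the next instruction if the reply is $\mathsf T$, otherwise skips the next instruction and proceeds with the one after; $-a$ likewise with reply roles reversed; $\#l$ proceeds with the $l$-th next instruction ($\#0$ causes inaction); $!$ terminates; if there is no instruction to proceed with, inaction occurs. $\mathcal{IS}_{br}$ is the set of instruction sequences whose basic instructions are all of the forms $\mathtt{in}{:}i.\mathtt{get}$, $\mathtt{aux}{:}i.\mathtt{get}$, $\mathtt{aux}{:}i.\mathtt{set{:}}b$, $\mathtt{out}.\mathtt{set{:}}b$. $X$ computes $f:\mathbb B^n\to\mathbb B$ if for all $b_1,\dots,b_n$, executing $X$ with $\mathtt{in}{:}i$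 initially $b_i$ ($i\le n$) and all auxiliary registers and $\mathtt{out}$ initially $\mathsf F$, execution never executes an instruction on $\mathtt{in}{:}i$ with $i>n$, ends by executing $!$, and leaves $f(b_1,\dots,b_n)$ in $\mathtt{out}$. A Boolean function family is a sequence $(f_n)_{n\in\mathbb N}$ with $f_n:\mathbb B^n\to\mathbb B$. For $\mathcal{IS}\subseteq\mathcal{IS}_{br}$ and a set $\mathcal F$ of functions $\mathbb N\to\mathbb N$: $\mathcal{IS}/\mathcal F$ is the class of families $(f_n)$ for which there is $h\in\mathcal F$ such that for every $n$ some $X\in\mathcal{IS}$ computes $f_n$ with $|X|\le h(n)$; $\mathcal N[\mathcal{IS}/\mathcal F]$ is the class of families $(f_n)$ for which there exist a monotonic $h\in\mathcal F$ and $(g_n)\in\mathcal{IS}/\mathcal F$ such that for all $n$ and $w\in\mathbb B^n$: $f_n(w)=\mathsf T\iff\exists c\in\mathbb B^{h(n)}\,g_{n+h(n)}(wc)=\mathsf T$. $\mathcal N[\mathcal{IS}/O(g(n))]$ denotes $\mathcal N[\mathcal{IS}/\mathcal F]$ with $\mathcal F=\{h:\mathbb N\to\mathbb N\mid h(n)=O(g(n))\}$. -}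

module Defs where

open import Data.Bool using (Bool; true; false; if_then_else_)
open import Data.Nat using (ℕ; zero; suc; _+_; _*_; _^_; _≤_)
open import Data.Vec using (Vec; []; _∷_; _++_)
open import Data.List using (List; []; _∷_)
open import Data.List.NonEmpty using (List⁺; toList; length)
open import Data.Maybe using (Maybe; just; nothing)
open import Data.Product using (Σ; ∃; ∃-syntax; _×_; _,_)
open import Relation.Binary.PropositionalEquality using (_≡_)
open import Function.Bundles using (_⇔_)
open import Relation.Nullary using (yes; no)
open import Data.Nat using (_≟_)
import Data.Maybe

-- Register index convention: the constructor argument i : ℕ denotes the
-- register with name-index (1 + i), i.e. inGet 0 is in:1.get, auxGet 0 is aux:1.get.

data BInstr : Set where
  inGet  : ℕ → BInstr
  auxGet : ℕ → BInstr
  auxSet : ℕ → Bool → BInstr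
  outSet : Bool → BInstr

data PInstr : Set where
  plain : BInstr → PInstr
  ptest : BInstr → PInstr
  ntest : BInstr → PInstr
  jump  : ℕ → PInstr
  halt  : PInstr

ISbr : Set
ISbr = List⁺ PInstr

-- Machine state: auxiliary registers and the output register
-- (input registers are read-only and given by the input vector).
record State : Set where
  constructor st
  field
    aux : ℕ → Bool
    out : Bool
open State

initState : State
initState = st (λ _ → false) false

data Outcome : Set where
  terminated : Bool → Outcome
  inaction   : Outcome
  badInput   : Outcome          -- an instruction on in:i with i > n was executed

readIn : {n : ℕ} → Vec Bool n → ℕ → Maybe Bool
readIn []      _       = nothing
readIn (b ∷ w) zero    = just b
readIn (b ∷ w) (suc i) = readIn w i

update : (ℕ → Bool) → ℕ → Bool → (ℕ → Bool)
update f i b j with i ≟ j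
... | yes _ = b
... | no  _ = f j

-- Effect of a basic instruction: reply and new state (nothing = illegal input access).
effect : {n : ℕ} → Vec Bool n → BInstr → State → Maybe (Bool × State)
effect w (inGet i)    s = Data.Maybe.map (λ b → b , s) (readIn w i)
effect w (auxGet i)   s = just (aux s i , s)
effect w (auxSet i b) s = just (b , st (update (aux s) i b) (out s))
effect w (outSet b)   s = just (b , st (aux s) b)

mutual
  exec : {n : ℕ} → Vec Bool n → List PInstr → State → Outcome
  exec w []                s = inaction
  exec w (plain a ∷ rest)  s with effect w a s
  ... | nothing       = badInput
  ... | just (_ , s') = exec w rest s'
  exec w (ptest a ∷ rest)  s with effect w a s
  ... | nothing           = badInput
  ... | just (true  , s') = exec w rest s'
  ... | just (false , s') = skip w 1 rest s'
  exec w (ntest a ∷ rest)  s with effect w a s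
  ... | nothing           = badInput
  ... | just (false , s') = exec w rest s'
  ... | just (true  , s') = skip w 1 rest s'
  exec w (jump zero ∷ rest)    s = inaction
  exec w (jump (suc m) ∷ rest) s = skip w m rest s
  exec w (halt ∷ rest)     s = terminated (out s)

  skip : {n : ℕ} → Vec Bool n → ℕ → List PInstr → State → Outcome
  skip w zero    l       s = exec w l s
  skip w (suc m) []      s = inaction
  skip w (suc m) (_ ∷ l) s = skip w m l s

Computes : {n : ℕ} → ISbr → (Vec Bool n → Bool) → Set
Computes {n} X f = (w : Vec Bool n) → exec w (toList X) initState ≡ terminated (f w)

Family : Set
Family = (n : ℕ) → Vec Bool n → Bool

BigO : (ℕ → ℕ) → (ℕ → ℕ) → Set
BigO h g = ∃[ c ] ∃[ n₀ ] ((n : ℕ) → n₀ ≤ n → h n ≤ c * g n)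

Monotonic : (ℕ → ℕ) → Set
Monotonic h = (m n : ℕ) → m ≤ n → h m ≤ h n

ISbr/O : (ℕ → ℕ) → Family → Set
ISbr/O g f = ∃[ h ] (BigO h g × ((n : ℕ) → ∃[ X ] (Computes X (f n) × length X ≤ h n)))

N[ISbr/O] : (ℕ → ℕ) → Family → Set
N[ISbr/O] g f =
  ∃[ h ] (Monotonic h × BigO h g ×
    ∃[ g' ] (ISbr/O g g' ×
      ((n : ℕ) (w : Vec Bool n) →
        (f n w ≡ true) ⇔ (∃[ c ] (g' (n + h n) (w ++ c) ≡ true)))))

-- Inclusion is monotonicity of the classes in the size bound. Strictness is by diagonalisation. A
-- program of length at most L on at most M inputs can be normalised (padded with #0 to length L, its
-- auxiliary registers renamed into aux:1 … aux:L, input indices and jumps clamped) without changing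
-- its behaviour, so it is one of A ^ L words over an alphabet of size A = O(M + L). Hence, restricted
-- to D input bits, the families in N[IS_br/O(n ^ k)] realise at most (h + 1) · A ^ L truth tables at
-- length n, with certificate length h ≤ n ^ (k + 1), L = n ^ (k ^ 2 + 1) and M = n + h. For n = 2 ^ t
-- and D = t (k ^ 2 + 2) this is fewer than 2 ^ (2 ^ D), so some table on D bits is missed; the family
-- evaluating it on the first D input bits is computed by a decision tree of size O(2 ^ D) = O(n ^ (k ^ 2 + 2)).

module Submission where

open import Defs
open import Data.Bool using (Bool; true; false; _∨_)
open import Data.Bool.Properties using (⇔→≡; ∨-zeroʳ)
open import Data.Empty using (⊥)
open import Data.Fin using (toℕ)
open import Data.Fin.Properties using (toℕ<n; toℕ-injective)
open import Data.List using (List; []; _∷_; _++_; length; map; replicate; upTo; cartesianProductWith; lookup)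
open import Data.List.Properties using (length-++; length-map; length-replicate; length-upTo; ++-assoc; ++-identityʳ)
open import Data.List.Membership.Propositional using (_∈_; _∉_)
open import Data.List.Membership.Propositional.Properties using (∈-++⁺ˡ; ∈-++⁺ʳ; ∈-map⁺; ∈-upTo⁺; ∈-cartesianProductWith⁺)
open import Data.List.Relation.Binary.Subset.Propositional using (_⊆_)
open import Data.List.Relation.Unary.All using (All; []; _∷_)
open import Data.List.Relation.Unary.Any using (here; there; index)
open import Data.List.Relation.Unary.Any.Properties using (lookup-index)
open import Data.List.NonEmpty as List⁺ using (List⁺; _∷_; toList)
open import Data.Maybe using (Maybe; just; nothing)
import Data.Maybe as Maybe
open import Data.Nat using (ℕ; zero; suc; _+_; _*_; _^_; _∸_; _⊓_; _≤_; _<_; z≤n; s≤s; _≟_; _≤?_; _<?_; >-nonZero)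
open import Data.Nat.Properties
open import Data.Nat.Solver using (module +-*-Solver)
open import Data.Nat.Logarithm using (⌊log₂_⌋; ⌊log₂[2^n]⌋≡n)
open import Data.List.Membership.DecPropositional _≟_ using (_∈?_)
open import Data.Product using (_×_; _,_; proj₁; proj₂; ∃-syntax)
open import Data.Sum using (inj₁; inj₂)
open import Data.Unit using (⊤; tt)
open import Data.Vec using (Vec; []; _∷_; take; drop; truncate; padRight)
import Data.Vec as Vec
open import Data.Vec.Properties using (take++drop≡id; truncate-padRight; ++-identityʳ-eqFree)
open import Data.Vec.Relation.Binary.Equality.Cast using (cast-is-id)
open import Function using (_∘_; _$_)
open import Function.Bundles using (_⇔_; mk⇔)
open import Function.Construct.Symmetry using (⇔-sym)
open import Function.Construct.Composition using (_⇔-∘_)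
open import Relation.Binary.PropositionalEquality
open import Relation.Nullary using (¬_; yes; no)
open import Relation.Nullary.Negation using (contradiction)
open State

module _ {n : ℕ} (w : Vec Bool n) where

  skip-++ : ∀ xs ys s → skip w (length xs) (xs ++ ys) s ≡ exec w ys s
  skip-++ []       ys s = refl
  skip-++ (x ∷ xs) ys s = skip-++ xs ys s

  skip-beyond : ∀ a xs s → length xs ≤ a → skip w a xs s ≡ inaction
  skip-beyond zero    []       s _         = refl
  skip-beyond (suc a) []       s _         = refl
  skip-beyond (suc a) (x ∷ xs) s (s≤s len) = skip-beyond a xs s len

  skip-⊓ : ∀ a L xs s → length xs ≤ L → skip w (a ⊓ L) xs s ≡ skip w a xs s
  skip-⊓ a L xs s len with ≤-total a L
  ... | inj₁ a≤L = cong (λ b → skip w b xs s) (m≤n⇒m⊓n≡m a≤L)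
  ... | inj₂ L≤a = trans (cong (λ b → skip w b xs s) (m≥n⇒m⊓n≡n L≤a))
                         (trans (skip-beyond L xs s len) (sym (skip-beyond a xs s (≤-trans len L≤a))))

  Inert : List PInstr → Set
  Inert ys = ∀ a s → skip w a ys s ≡ inaction

  mutual
    exec-++-inert : ∀ {ys} → Inert ys → ∀ xs s → exec w (xs ++ ys) s ≡ exec w xs s
    exec-++-inert inert [] s = inert 0 s
    exec-++-inert inert (plain a ∷ xs) s with effect w a s
    ... | nothing       = refl
    ... | just (_ , s') = exec-++-inert inert xs s'
    exec-++-inert inert (ptest a ∷ xs) s with effect w a s
    ... | nothing           = refl
    ... | just (true  , s') = exec-++-inert inert xs s'
    ... | just (false , s') = skip-++-inert inert 1 xs s'
    exec-++-inert inert (ntest a ∷ xs) s with effect w a s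
    ... | nothing           = refl
    ... | just (false , s') = exec-++-inert inert xs s'
    ... | just (true  , s') = skip-++-inert inert 1 xs s'
    exec-++-inert inert (jump zero    ∷ xs) s = refl
    exec-++-inert inert (jump (suc l) ∷ xs) s = skip-++-inert inert l xs s
    exec-++-inert inert (halt ∷ xs)         s = refl

    skip-++-inert : ∀ {ys} → Inert ys → ∀ a xs s → skip w a (xs ++ ys) s ≡ skip w a xs s
    skip-++-inert inert zero    xs       s = exec-++-inert inert xs s
    skip-++-inert inert (suc a) []       s = inert (suc a) s
    skip-++-inert inert (suc a) (x ∷ xs) s = skip-++-inert inert a xs s

  inert-jump0s : ∀ r → Inert (replicate r (jump 0))
  inert-jump0s zero    zero    s = refl
  inert-jump0s (suc r) zero    s = refl
  inert-jump0s zero    (suc a) s = refl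
  inert-jump0s (suc r) (suc a) s = inert-jump0s r a s

-- Normal forms of short programs

registersB : BInstr → List ℕ
registersB (auxGet i)   = i ∷ []
registersB (auxSet i _) = i ∷ []
registersB _            = []

registersP : PInstr → List ℕ
registersP (plain a) = registersB a
registersP (ptest a) = registersB a
registersP (ntest a) = registersB a
registersP _         = []

registers : List PInstr → List ℕ
registers []       = []
registers (x ∷ xs) = registersP x ++ registers xs

length-registersB : ∀ a → length (registersB a) ≤ 1
length-registersB (inGet _)    = z≤n
length-registersB (auxGet _)   = ≤-refl
length-registersB (auxSet _ _) = ≤-refl
length-registersB (outSet _)   = z≤n

length-registersP : ∀ x → length (registersP x) ≤ 1
length-registersP (plain a) = length-registersB a
length-registersP (ptest a) = length-registersB a
length-registersP (ntest a) = length-registersB a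
length-registersP (jump _)  = z≤n
length-registersP halt      = z≤n

length-registers : ∀ xs → length (registers xs) ≤ length xs
length-registers []       = z≤n
length-registers (x ∷ xs) = begin
  length (registersP x ++ registers xs)          ≡⟨ length-++ (registersP x) ⟩
  length (registersP x) + length (registers xs)  ≤⟨ +-mono-≤ (length-registersP x) (length-registers xs) ⟩
  suc (length xs)                                ∎
  where open ≤-Reasoning

slot : List ℕ → ℕ → ℕ
slot U i with i ∈? U
... | yes i∈U = toℕ (index i∈U)
... | no  _   = 0

slot-< : ∀ U {i} → i ∈ U → slot U i < length U
slot-< U {i} i∈U with i ∈? U
... | yes p = toℕ<n (index p)
... | no ¬p = contradiction i∈U ¬p

slot-injective : ∀ U {i j} → i ∈ U → j ∈ U → slot U i ≡ slot U j → i ≡ j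
slot-injective U {i} {j} i∈U j∈U eq with i ∈? U | j ∈? U
... | yes p | yes q = trans (lookup-index p) (trans (cong (lookup U) (toℕ-injective eq)) (sym (lookup-index q)))
... | no ¬p | _     = contradiction i∈U ¬p
... | _     | no ¬q = contradiction j∈U ¬q

-- Input indices are clamped to n (in:(n+1) is as absent as any later register) and
-- jumps to L + 1 (in a program of length L both overshoot its end).
normaliseB : ℕ → (ℕ → ℕ) → BInstr → BInstr
normaliseB n ρ (inGet i)    = inGet (i ⊓ n)
normaliseB n ρ (auxGet i)   = auxGet (ρ i)
normaliseB n ρ (auxSet i b) = auxSet (ρ i) b
normaliseB n ρ (outSet b)   = outSet b

normaliseP : ℕ → (ℕ → ℕ) → ℕ → PInstr → PInstr
normaliseP n ρ L (plain a) = plain (normaliseB n ρ a)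
normaliseP n ρ L (ptest a) = ptest (normaliseB n ρ a)
normaliseP n ρ L (ntest a) = ntest (normaliseB n ρ a)
normaliseP n ρ L (jump l)  = jump (l ⊓ suc L)
normaliseP n ρ L halt      = halt

readIn-⊓ : ∀ {n} (w : Vec Bool n) i → readIn w (i ⊓ n) ≡ readIn w i
readIn-⊓ []      i       = refl
readIn-⊓ (b ∷ w) zero    = refl
readIn-⊓ (b ∷ w) (suc i) = readIn-⊓ w i

module Normalisation {n : ℕ} (w : Vec Bool n) (U : List ℕ) (ρ : ℕ → ℕ)
         (ρ-injective : ∀ {i j} → i ∈ U → j ∈ U → ρ i ≡ ρ j → i ≡ j) (L : ℕ) where

  Tracks : State → State → Set
  Tracks s s' = (∀ {i} → i ∈ U → aux s' (ρ i) ≡ aux s i) × out s' ≡ out s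

  data SameEffect : Maybe (Bool × State) → Maybe (Bool × State) → Set where
    both-fail  : SameEffect nothing nothing
    same-reply : ∀ r {t t'} → Tracks t t' → SameEffect (just (r , t)) (just (r , t'))

  tracks-update : ∀ {s s'} i b → i ∈ U → Tracks s s' →
    Tracks (st (update (aux s) i b) (out s)) (st (update (aux s') (ρ i) b) (out s'))
  tracks-update {s} {s'} i b i∈U (same-aux , same-out) = same-aux′ , same-out
    where
    same-aux′ : ∀ {j} → j ∈ U → update (aux s') (ρ i) b (ρ j) ≡ update (aux s) i b j
    same-aux′ {j} j∈U with ρ i ≟ ρ j | i ≟ j
    ... | yes _  | yes _  = refl
    ... | no  _  | no  _  = same-aux j∈U
    ... | yes ρ≡ | no  i≢ = contradiction (ρ-injective i∈U j∈U ρ≡) i≢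
    ... | no  ρ≢ | yes i≡ = contradiction (cong ρ i≡) ρ≢

  read-effect : ∀ {s s'} → Tracks s s' → (mb : Maybe Bool) →
    SameEffect (Maybe.map (_, s) mb) (Maybe.map (_, s') mb)
  read-effect R nothing  = both-fail
  read-effect R (just b) = same-reply b R

  effect-normaliseB : ∀ a {s s'} → registersB a ⊆ U → Tracks s s' →
    SameEffect (effect w a s) (effect w (normaliseB n ρ a) s')
  effect-normaliseB (inGet i) _ R rewrite readIn-⊓ w i = read-effect R (readIn w i)
  effect-normaliseB (auxGet i) {s} sub R rewrite proj₁ R (sub (here refl)) = same-reply (aux s i) R
  effect-normaliseB (auxSet i b) sub R = same-reply b (tracks-update i b (sub (here refl)) R)
  effect-normaliseB (outSet b) _ (same-aux , _) = same-reply b (same-aux , refl)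

  normalise : PInstr → PInstr
  normalise = normaliseP n ρ L

  mutual
    exec-normalise : ∀ xs {s s'} → registers xs ⊆ U → length xs ≤ L → Tracks s s' →
      exec w (map normalise xs) s' ≡ exec w xs s
    exec-normalise [] _ _ _ = refl
    exec-normalise (plain a ∷ xs) {s} {s'} sub len R
      with effect w a s | effect w (normaliseB n ρ a) s' | effect-normaliseB a {s} {s'} (sub ∘ ∈-++⁺ˡ) R
    ... | _ | _ | both-fail       = refl
    ... | _ | _ | same-reply _ R' = exec-normalise xs (sub ∘ ∈-++⁺ʳ (registersB a)) (<⇒≤ len) R'
    exec-normalise (ptest a ∷ xs) {s} {s'} sub len R
      with effect w a s | effect w (normaliseB n ρ a) s' | effect-normaliseB a {s} {s'} (sub ∘ ∈-++⁺ˡ) R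
    ... | _ | _ | both-fail           = refl
    ... | _ | _ | same-reply true  R' = exec-normalise xs (sub ∘ ∈-++⁺ʳ (registersB a)) (<⇒≤ len) R'
    ... | _ | _ | same-reply false R' = skip-normalise 1 xs (sub ∘ ∈-++⁺ʳ (registersB a)) (<⇒≤ len) R'
    exec-normalise (ntest a ∷ xs) {s} {s'} sub len R
      with effect w a s | effect w (normaliseB n ρ a) s' | effect-normaliseB a {s} {s'} (sub ∘ ∈-++⁺ˡ) R
    ... | _ | _ | both-fail           = refl
    ... | _ | _ | same-reply false R' = exec-normalise xs (sub ∘ ∈-++⁺ʳ (registersB a)) (<⇒≤ len) R'
    ... | _ | _ | same-reply true  R' = skip-normalise 1 xs (sub ∘ ∈-++⁺ʳ (registersB a)) (<⇒≤ len) R'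
    exec-normalise (jump zero ∷ xs) _ _ _ = refl
    exec-normalise (jump (suc l) ∷ xs) {s} {s'} sub len R =
      trans (skip-⊓ w l L (map normalise xs) s' (≤-trans (≤-reflexive (length-map normalise xs)) (<⇒≤ len)))
            (skip-normalise l xs sub (<⇒≤ len) R)
    exec-normalise (halt ∷ xs) _ _ (_ , same-out) = cong terminated same-out

    skip-normalise : ∀ a xs {s s'} → registers xs ⊆ U → length xs ≤ L → Tracks s s' →
      skip w a (map normalise xs) s' ≡ skip w a xs s
    skip-normalise zero    xs       sub len R = exec-normalise xs sub len R
    skip-normalise (suc a) []       sub len R = refl
    skip-normalise (suc a) (x ∷ xs) sub len R =
      skip-normalise a xs (sub ∘ ∈-++⁺ʳ (registersP x)) (<⇒≤ len) R

length-cartesianProductWith : ∀ {A B C : Set} (f : A → B → C) xs ys →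
  length (cartesianProductWith f xs ys) ≡ length xs * length ys
length-cartesianProductWith f []       ys = refl
length-cartesianProductWith f (x ∷ xs) ys = begin
  length (map (f x) ys ++ cartesianProductWith f xs ys)        ≡⟨ length-++ (map (f x) ys) ⟩
  length (map (f x) ys) + length (cartesianProductWith f xs ys) ≡⟨ cong₂ _+_ (length-map (f x) ys) (length-cartesianProductWith f xs ys) ⟩
  length ys + length xs * length ys                             ∎
  where open ≡-Reasoning

words : {A : Set} → List A → ℕ → List (List A)
words cs zero    = [] ∷ []
words cs (suc L) = cartesianProductWith _∷_ cs (words cs L)

length-words : ∀ {A : Set} (cs : List A) L → length (words cs L) ≡ length cs ^ L
length-words cs zero    = refl
length-words cs (suc L) =
  trans (length-cartesianProductWith _∷_ cs (words cs L)) (cong (length cs *_) (length-words cs L))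

∈-words : ∀ {A : Set} {cs : List A} {xs} → All (_∈ cs) xs → xs ∈ words cs (length xs)
∈-words []         = here refl
∈-words (x∈ ∷ xs∈) = ∈-cartesianProductWith⁺ _∷_ x∈ (∈-words xs∈)

booleans : List Bool
booleans = true ∷ false ∷ []

∈-booleans : ∀ b → b ∈ booleans
∈-booleans true  = here refl
∈-booleans false = there (here refl)

basicInstructions : ℕ → ℕ → List BInstr
basicInstructions M L =
  map inGet (upTo (suc M)) ++ map auxGet (upTo L) ++
  cartesianProductWith auxSet (upTo L) booleans ++ map outSet booleans

modes : List (BInstr → PInstr)
modes = plain ∷ ptest ∷ ntest ∷ []

instructions : ℕ → ℕ → List PInstr
instructions M L =
  cartesianProductWith _$_ modes (basicInstructions M L) ++
  map jump (upTo (2 + L)) ++ halt ∷ []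

length-basicInstructions : ∀ M L → length (basicInstructions M L) ≡ suc M + (L + (L * 2 + 2))
length-basicInstructions M L =
  trans (length-++ (map inGet (upTo (suc M)))) (cong₂ _+_ (length-map-upTo inGet (suc M))
  (trans (length-++ (map auxGet (upTo L))) (cong₂ _+_ (length-map-upTo auxGet L)
  (trans (length-++ (cartesianProductWith auxSet (upTo L) booleans))
         (cong₂ _+_ (trans (length-cartesianProductWith auxSet (upTo L) booleans) (cong (_* 2) (length-upTo L)))
                    (length-map outSet booleans))))))
  where
  length-map-upTo : ∀ {B : Set} (f : ℕ → B) k → length (map f (upTo k)) ≡ k
  length-map-upTo f k = trans (length-map f (upTo k)) (length-upTo k)

length-instructions : ∀ M L → length (instructions M L) ≡ 3 * (suc M + (L + (L * 2 + 2))) + (2 + L + 1)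
length-instructions M L =
  trans (length-++ (cartesianProductWith _$_ modes (basicInstructions M L)))
  (cong₂ _+_ (trans (length-cartesianProductWith _$_ modes (basicInstructions M L))
                    (cong (3 *_) (length-basicInstructions M L)))
  (trans (length-++ (map jump (upTo (2 + L))))
         (cong (_+ 1) (trans (length-map jump (upTo (2 + L))) (length-upTo (2 + L))))))

length-instructions-≤ : ∀ M L → M ≤ L + L → 1 ≤ L → length (instructions M L) ≤ 28 * L
length-instructions-≤ M L M≤2L 1≤L = begin
  length (instructions M L)                       ≡⟨ length-instructions M L ⟩
  3 * (suc M + (L + (L * 2 + 2))) + (2 + L + 1)   ≡⟨ solve 2 (λ M L → con 3 :* ((con 1 :+ M) :+ (L :+ (L :* con 2 :+ con 2))) :+ (con 2 :+ L :+ con 1) := con 3 :* M :+ con 10 :* L :+ con 12) refl M L ⟩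
  3 * M + 10 * L + 12                             ≤⟨ +-mono-≤ (+-monoˡ-≤ (10 * L) (*-monoʳ-≤ 3 M≤2L)) (*-monoʳ-≤ 12 1≤L) ⟩
  3 * (L + L) + 10 * L + 12 * L                   ≡⟨ solve 1 (λ L → con 3 :* (L :+ L) :+ con 10 :* L :+ con 12 :* L := con 28 :* L) refl L ⟩
  28 * L                                          ∎
  where
  open ≤-Reasoning
  open +-*-Solver

M<length-instructions : ∀ M L → M < length (instructions M L)
M<length-instructions M L = begin-strict
  M                                               <⟨ n<1+n M ⟩
  suc M                                           ≤⟨ m≤m+n (suc M) _ ⟩
  suc M + (L + (L * 2 + 2))                       ≤⟨ m≤m+n _ _ ⟩
  3 * (suc M + (L + (L * 2 + 2)))                 ≤⟨ m≤m+n _ _ ⟩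
  3 * (suc M + (L + (L * 2 + 2))) + (2 + L + 1)   ≡⟨ length-instructions M L ⟨
  length (instructions M L)                       ∎
  where open ≤-Reasoning

normaliseB-∈ : ∀ {m M L ρ} a → m ≤ M → (∀ {i} → i ∈ registersB a → ρ i < L) →
  normaliseB m ρ a ∈ basicInstructions M L
normaliseB-∈ {m} {M} (inGet i) m≤M _ =
  ∈-++⁺ˡ (∈-map⁺ inGet (∈-upTo⁺ (s≤s (≤-trans (m⊓n≤n i m) m≤M))))
normaliseB-∈ {M = M} (auxGet i) _ ρ< =
  ∈-++⁺ʳ (map inGet (upTo (suc M))) (∈-++⁺ˡ (∈-map⁺ auxGet (∈-upTo⁺ (ρ< (here refl)))))
normaliseB-∈ {M = M} {L} (auxSet i b) _ ρ< =
  ∈-++⁺ʳ (map inGet (upTo (suc M))) (∈-++⁺ʳ (map auxGet (upTo L))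
    (∈-++⁺ˡ (∈-cartesianProductWith⁺ auxSet (∈-upTo⁺ (ρ< (here refl))) (∈-booleans b))))
normaliseB-∈ {M = M} {L} (outSet b) _ _ =
  ∈-++⁺ʳ (map inGet (upTo (suc M))) (∈-++⁺ʳ (map auxGet (upTo L))
    (∈-++⁺ʳ (cartesianProductWith auxSet (upTo L) booleans) (∈-map⁺ outSet (∈-booleans b))))

normaliseP-∈ : ∀ {m M L ρ} x → m ≤ M → (∀ {i} → i ∈ registersP x → ρ i < L) →
  normaliseP m ρ L x ∈ instructions M L
normaliseP-∈ (plain a) m≤M ρ< = ∈-++⁺ˡ (∈-cartesianProductWith⁺ _$_ {xs = modes} (here refl) (normaliseB-∈ a m≤M ρ<))
normaliseP-∈ (ptest a) m≤M ρ< = ∈-++⁺ˡ (∈-cartesianProductWith⁺ _$_ {xs = modes} (there (here refl)) (normaliseB-∈ a m≤M ρ<))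
normaliseP-∈ (ntest a) m≤M ρ< = ∈-++⁺ˡ (∈-cartesianProductWith⁺ _$_ {xs = modes} (there (there (here refl))) (normaliseB-∈ a m≤M ρ<))
normaliseP-∈ {M = M} {L} (jump l) _ _ =
  ∈-++⁺ʳ (cartesianProductWith _$_ modes (basicInstructions M L))
    (∈-++⁺ˡ (∈-map⁺ jump (∈-upTo⁺ (s≤s (m⊓n≤n l (suc L))))))
normaliseP-∈ {M = M} {L} halt _ _ =
  ∈-++⁺ʳ (cartesianProductWith _$_ modes (basicInstructions M L))
    (∈-++⁺ʳ (map jump (upTo (2 + L))) (here refl))

canonicalise : ∀ {m} M L (X : List PInstr) → m ≤ M → length X ≤ L →
  ∃[ P ] (P ∈ words (instructions M L) L × ∀ (v : Vec Bool m) → exec v P initState ≡ exec v X initState)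
canonicalise {m} M L X m≤M |X|≤L = P , P∈ , P≈X
  where
  padded : List PInstr
  padded = X ++ replicate (L ∸ length X) (jump 0)

  U : List ℕ
  U = registers padded

  P : List PInstr
  P = map (normaliseP m (slot U) L) padded

  length-padded : length padded ≡ L
  length-padded = trans (length-++ X)
    (trans (cong (length X +_) (length-replicate (L ∸ length X))) (m+[n∸m]≡n |X|≤L))

  slot<L : ∀ {i} → i ∈ U → slot U i < L
  slot<L i∈U = <-≤-trans (slot-< U i∈U) (≤-trans (length-registers padded) (≤-reflexive length-padded))

  normalised-∈ : ∀ xs → registers xs ⊆ U → All (_∈ instructions M L) (map (normaliseP m (slot U) L) xs)
  normalised-∈ []       _   = []
  normalised-∈ (x ∷ xs) sub =
    normaliseP-∈ x m≤M (slot<L ∘ sub ∘ ∈-++⁺ˡ) ∷ normalised-∈ xs (sub ∘ ∈-++⁺ʳ (registersP x))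

  P∈ : P ∈ words (instructions M L) L
  P∈ = subst (λ l → P ∈ words (instructions M L) l) (trans (length-map _ padded) length-padded)
             (∈-words (normalised-∈ padded (λ i∈U → i∈U)))

  P≈X : ∀ v → exec v P initState ≡ exec v X initState
  P≈X v = trans (Normalisation.exec-normalise v U (slot U) (slot-injective U) L padded
                   (λ i∈U → i∈U) (≤-reflexive length-padded) ((λ _ → refl) , refl))
                (exec-++-inert v (inert-jump0s v _) X initState)

-- Truth tables and decision trees

TruthTable : ℕ → Set
TruthTable d = Vec Bool (2 ^ d)

-- 2 ^ suc d unfolds to 2 ^ d + (2 ^ d + 0): the rows for a leading true, then for a leading false.
evalTable : ∀ d → TruthTable d → Vec Bool d → Bool
evalTable zero    (b ∷ []) []          = b
evalTable (suc d) t        (true  ∷ e) = evalTable d (take (2 ^ d) t) e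
evalTable (suc d) t        (false ∷ e) = evalTable d (take (2 ^ d) (drop (2 ^ d) t)) e

truthTable : ∀ d → (Vec Bool d → Bool) → TruthTable d
truthTable zero    F = F [] ∷ []
truthTable (suc d) F = truthTable d (F ∘ (true ∷_)) Vec.++ (truthTable d (F ∘ (false ∷_)) Vec.++ [])

truthTable-cong : ∀ d {F G : Vec Bool d → Bool} → (∀ e → F e ≡ G e) → truthTable d F ≡ truthTable d G
truthTable-cong zero    F≗G = cong (_∷ []) (F≗G [])
truthTable-cong (suc d) F≗G = cong₂ (λ t f → t Vec.++ (f Vec.++ []))
  (truthTable-cong d (F≗G ∘ (true ∷_))) (truthTable-cong d (F≗G ∘ (false ∷_)))

truthTable-evalTable : ∀ d (t : TruthTable d) → truthTable d (evalTable d t) ≡ t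
truthTable-evalTable zero    (b ∷ []) = refl
truthTable-evalTable (suc d) t = begin
  truthTable d (evalTable d (take (2 ^ d) t)) Vec.++ (truthTable d (evalTable d (take (2 ^ d) rest)) Vec.++ [])
    ≡⟨ cong₂ (λ u v → u Vec.++ (v Vec.++ [])) (truthTable-evalTable d _) (truthTable-evalTable d _) ⟩
  take (2 ^ d) t Vec.++ (take (2 ^ d) rest Vec.++ [])
    ≡⟨ cong (λ z → take (2 ^ d) t Vec.++ (take (2 ^ d) rest Vec.++ z)) (empty (drop (2 ^ d) rest)) ⟩
  take (2 ^ d) t Vec.++ (take (2 ^ d) rest Vec.++ drop (2 ^ d) rest)
    ≡⟨ cong (take (2 ^ d) t Vec.++_) (take++drop≡id (2 ^ d) rest) ⟩
  take (2 ^ d) t Vec.++ rest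
    ≡⟨ take++drop≡id (2 ^ d) t ⟩
  t ∎
  where
  open ≡-Reasoning
  rest : Vec Bool (2 ^ d + 0)
  rest = drop (2 ^ d) t
  empty : (v : Vec Bool 0) → [] ≡ v
  empty [] = refl

-- Tests in:(j+1), in:(j+2), … ; a failed test skips the #2 and lands on the jump over the true-subtree.
decisionTree : ℕ → (d : ℕ) → TruthTable d → List⁺ PInstr
decisionTree j zero    (b ∷ []) = plain (outSet b) ∷ halt ∷ []
decisionTree j (suc d) t =
  ptest (inGet j) ∷ jump 2 ∷ jump (suc (List⁺.length onTrue)) ∷ toList onTrue ++ toList onFalse
  where
  onTrue onFalse : List⁺ PInstr
  onTrue  = decisionTree (suc j) d (take (2 ^ d) t)
  onFalse = decisionTree (suc j) d (take (2 ^ d) (drop (2 ^ d) t))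

length-decisionTree : ∀ j d t → List⁺.length (decisionTree j d t) + 3 ≤ 5 * 2 ^ d
length-decisionTree j zero    (b ∷ []) = ≤-refl
length-decisionTree j (suc d) t = begin
  3 + length (toList T ++ toList F) + 3          ≡⟨ cong (λ l → 3 + l + 3) (length-++ (toList T)) ⟩
  3 + (List⁺.length T + List⁺.length F) + 3      ≡⟨ solve 2 (λ x y → con 3 :+ (x :+ y) :+ con 3 := (x :+ con 3) :+ (y :+ con 3)) refl (List⁺.length T) (List⁺.length F) ⟩
  (List⁺.length T + 3) + (List⁺.length F + 3)    ≤⟨ +-mono-≤ (length-decisionTree (suc j) d _) (length-decisionTree (suc j) d _) ⟩
  5 * 2 ^ d + 5 * 2 ^ d                          ≡⟨ solve 1 (λ x → con 5 :* x :+ con 5 :* x := con 5 :* (x :+ (x :+ con 0))) refl (2 ^ d) ⟩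
  5 * 2 ^ suc d                                  ∎
  where
  open ≤-Reasoning
  open +-*-Solver
  T F : List⁺ PInstr
  T = decisionTree (suc j) d (take (2 ^ d) t)
  F = decisionTree (suc j) d (take (2 ^ d) (drop (2 ^ d) t))

StoredAt : ∀ {n} → Vec Bool n → ℕ → ∀ {d} → Vec Bool d → Set
StoredAt w j []      = ⊤
StoredAt w j (b ∷ e) = readIn w j ≡ just b × StoredAt w (suc j) e

storedAt-∷ : ∀ {n d} (w : Vec Bool n) b j (e : Vec Bool d) → StoredAt w j e → StoredAt (b ∷ w) (suc j) e
storedAt-∷ w b j []      _            = tt
storedAt-∷ w b j (x ∷ e) (read , rest) = read , storedAt-∷ w b (suc j) e rest

storedAt-truncate : ∀ {d n} (d≤n : d ≤ n) (w : Vec Bool n) → StoredAt w 0 (truncate d≤n w)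
storedAt-truncate z≤n       w       = tt
storedAt-truncate (s≤s d≤n) (b ∷ w) = refl , storedAt-∷ w b 0 (truncate d≤n w) (storedAt-truncate d≤n w)

decisionTree-correct : ∀ {n} (w : Vec Bool n) j d t (e : Vec Bool d) rest s → StoredAt w j e →
  exec w (toList (decisionTree j d t) ++ rest) s ≡ terminated (evalTable d t e)
decisionTree-correct w j zero (b ∷ []) [] rest s _ = refl
decisionTree-correct w j (suc d) t (true ∷ e) rest s (read , stored) rewrite read =
  trans (cong (λ z → exec w z s) (++-assoc (toList onTrue) (toList onFalse) rest))
        (decisionTree-correct w (suc j) d _ e _ s stored)
  where
  onTrue onFalse : List⁺ PInstr
  onTrue  = decisionTree (suc j) d (take (2 ^ d) t)
  onFalse = decisionTree (suc j) d (take (2 ^ d) (drop (2 ^ d) t))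
decisionTree-correct w j (suc d) t (false ∷ e) rest s (read , stored) rewrite read = begin
  skip w (List⁺.length onTrue) ((toList onTrue ++ toList onFalse) ++ rest) s
    ≡⟨ cong (λ z → skip w (List⁺.length onTrue) z s) (++-assoc (toList onTrue) (toList onFalse) rest) ⟩
  skip w (List⁺.length onTrue) (toList onTrue ++ (toList onFalse ++ rest)) s
    ≡⟨ skip-++ w (toList onTrue) _ s ⟩
  exec w (toList onFalse ++ rest) s
    ≡⟨ decisionTree-correct w (suc j) d _ e _ s stored ⟩
  terminated (evalTable (suc d) t (false ∷ e)) ∎
  where
  open ≡-Reasoning
  onTrue onFalse : List⁺ PInstr
  onTrue  = decisionTree (suc j) d (take (2 ^ d) t)
  onFalse = decisionTree (suc j) d (take (2 ^ d) (drop (2 ^ d) t))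

-- A table missing from a short list

splitByHead : ∀ {N} → List (Vec Bool (suc N)) → List (Vec Bool N) × List (Vec Bool N)
splitByHead []                 = [] , []
splitByHead ((true  ∷ v) ∷ vs) = v ∷ proj₁ (splitByHead vs) , proj₂ (splitByHead vs)
splitByHead ((false ∷ v) ∷ vs) = proj₁ (splitByHead vs) , v ∷ proj₂ (splitByHead vs)

length-splitByHead : ∀ {N} (vs : List (Vec Bool (suc N))) →
  length (proj₁ (splitByHead vs)) + length (proj₂ (splitByHead vs)) ≡ length vs
length-splitByHead []                 = refl
length-splitByHead ((true  ∷ v) ∷ vs) = cong suc (length-splitByHead vs)
length-splitByHead ((false ∷ v) ∷ vs) = trans (+-suc _ _) (cong suc (length-splitByHead vs))

splitByHead-true : ∀ {N} {v : Vec Bool N} vs → (true ∷ v) ∈ vs → v ∈ proj₁ (splitByHead vs)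
splitByHead-true ((true  ∷ _) ∷ vs) (here refl) = here refl
splitByHead-true ((true  ∷ _) ∷ vs) (there p)   = there (splitByHead-true vs p)
splitByHead-true ((false ∷ _) ∷ vs) (there p)   = splitByHead-true vs p

splitByHead-false : ∀ {N} {v : Vec Bool N} vs → (false ∷ v) ∈ vs → v ∈ proj₂ (splitByHead vs)
splitByHead-false ((false ∷ _) ∷ vs) (here refl) = here refl
splitByHead-false ((false ∷ _) ∷ vs) (there p)   = there (splitByHead-false vs p)
splitByHead-false ((true  ∷ _) ∷ vs) (there p)   = splitByHead-false vs p

-- Always continue in the half with fewer vectors, so the count stays below 2 ^ N.
missing : (N : ℕ) → List (Vec Bool N) → Vec Bool N
missing zero    vs = []
missing (suc N) vs with length (proj₁ (splitByHead vs)) ≤? length (proj₂ (splitByHead vs))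
... | yes _ = true  ∷ missing N (proj₁ (splitByHead vs))
... | no  _ = false ∷ missing N (proj₂ (splitByHead vs))

smaller-half : ∀ {a b c} → a ≤ b → a + b < c + c → a < c
smaller-half {a} {b} {c} a≤b a+b<c+c with a <? c
... | yes a<c = a<c
... | no  a≮c = contradiction a+b<c+c (≤⇒≯ (+-mono-≤ (≮⇒≥ a≮c) (≤-trans (≮⇒≥ a≮c) a≤b)))

missing-∉ : ∀ N vs → length vs < 2 ^ N → missing N vs ∉ vs
missing-∉ zero    []       _          ()
missing-∉ zero    (_ ∷ vs) (s≤s ())
missing-∉ (suc N) vs       |vs|<2^N+1 with length (proj₁ (splitByHead vs)) ≤? length (proj₂ (splitByHead vs))
... | yes T≤F = λ m∈vs → missing-∉ N (proj₁ (splitByHead vs)) (smaller-half T≤F split<) (splitByHead-true vs m∈vs)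
  where
  split< : length (proj₁ (splitByHead vs)) + length (proj₂ (splitByHead vs)) < 2 ^ N + 2 ^ N
  split< = subst₂ _<_ (sym (length-splitByHead vs)) (cong (2 ^ N +_) (+-identityʳ (2 ^ N))) |vs|<2^N+1
... | no  T≰F = λ m∈vs → missing-∉ N (proj₂ (splitByHead vs)) (smaller-half (<⇒≤ (≰⇒> T≰F)) split<) (splitByHead-false vs m∈vs)
  where
  split< : length (proj₂ (splitByHead vs)) + length (proj₁ (splitByHead vs)) < 2 ^ N + 2 ^ N
  split< = subst₂ _<_ (trans (sym (length-splitByHead vs)) (+-comm (length (proj₁ (splitByHead vs))) _))
                      (cong (2 ^ N +_) (+-identityʳ (2 ^ N))) |vs|<2^N+1

BigO-trans : ∀ {f g h} → BigO f g → BigO g h → BigO f h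
BigO-trans {f} {g} {h} (a , n₁ , f≤ag) (b , n₂ , g≤bh) = a * b , n₁ + n₂ , bound
  where
  bound : ∀ n → n₁ + n₂ ≤ n → f n ≤ a * b * h n
  bound n n₁+n₂≤n = begin
    f n            ≤⟨ f≤ag n (≤-trans (m≤m+n n₁ n₂) n₁+n₂≤n) ⟩
    a * g n        ≤⟨ *-monoʳ-≤ a (g≤bh n (≤-trans (m≤n+m n₂ n₁) n₁+n₂≤n)) ⟩
    a * (b * h n)  ≡⟨ *-assoc a b (h n) ⟨
    a * b * h n    ∎
    where open ≤-Reasoning

BigO-^ : ∀ {a b} → a ≤ b → BigO (λ n → n ^ a) (λ n → n ^ b)
BigO-^ {a} {b} a≤b = 1 , 1 , bound
  where
  bound : ∀ n → 1 ≤ n → n ^ a ≤ 1 * n ^ b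
  bound (suc n) _ = ≤-trans (^-monoʳ-≤ (suc n) a≤b) (≤-reflexive (sym (*-identityˡ _)))

ISbr/O-mono : ∀ {g g' f} → BigO g g' → ISbr/O g f → ISbr/O g' f
ISbr/O-mono g=O[g'] (h , h=O[g] , programs) = h , BigO-trans h=O[g] g=O[g'] , programs

N[ISbr/O]-mono : ∀ {g g' f} → BigO g g' → N[ISbr/O] g f → N[ISbr/O] g' f
N[ISbr/O]-mono g=O[g'] (h , h-mono , h=O[g] , f' , f'∈ , f⇔f') =
  h , h-mono , BigO-trans h=O[g] g=O[g'] , f' , ISbr/O-mono g=O[g'] f'∈ , f⇔f'

ISbr/O⊆N[ISbr/O] : ∀ {g f} → ISbr/O g f → N[ISbr/O] g f
ISbr/O⊆N[ISbr/O] {f = f} f∈ = (λ _ → 0) , (λ _ _ _ → z≤n) , (0 , 0 , λ _ _ → z≤n) , f , f∈ , f⇔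
  where
  f-cast : ∀ {m n} (eq : m ≡ n) (v : Vec Bool m) → f m v ≡ f n (Vec.cast eq v)
  f-cast refl v = cong (f _) (sym (cast-is-id refl v))

  f⇔ : ∀ n (w : Vec Bool n) → f n w ≡ true ⇔ (∃[ c ] f (n + 0) (w Vec.++ c) ≡ true)
  f⇔ n w = mk⇔ (λ fw → [] , trans f[w++[]]≡fw fw) (λ { ([] , fw) → trans (sym f[w++[]]≡fw) fw })
    where
    f[w++[]]≡fw : f (n + 0) (w Vec.++ []) ≡ f n w
    f[w++[]]≡fw = trans (f-cast (+-identityʳ n) _) (cong (f n) (++-identityʳ-eqFree w))

anyVec : (h : ℕ) → (Vec Bool h → Bool) → Bool
anyVec zero    p = p []
anyVec (suc h) p = anyVec h (p ∘ (true ∷_)) ∨ anyVec h (p ∘ (false ∷_))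

anyVec-cong : ∀ h {p q : Vec Bool h → Bool} → (∀ c → p c ≡ q c) → anyVec h p ≡ anyVec h q
anyVec-cong zero    p≗q = p≗q []
anyVec-cong (suc h) p≗q = cong₂ _∨_ (anyVec-cong h (p≗q ∘ (true ∷_))) (anyVec-cong h (p≗q ∘ (false ∷_)))

anyVec-sound : ∀ h p → anyVec h p ≡ true → ∃[ c ] p c ≡ true
anyVec-sound zero    p any = [] , any
anyVec-sound (suc h) p any with anyVec h (p ∘ (true ∷_)) in anyTrue
... | true  = let c , pc = anyVec-sound h _ anyTrue in true ∷ c , pc
... | false = let c , pc = anyVec-sound h _ any in false ∷ c , pc

anyVec-complete : ∀ h p (c : Vec Bool h) → p c ≡ true → anyVec h p ≡ true
anyVec-complete zero    p []          pc = pc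
anyVec-complete (suc h) p (true ∷ c)  pc rewrite anyVec-complete h (p ∘ (true ∷_)) c pc = refl
anyVec-complete (suc h) p (false ∷ c) pc rewrite anyVec-complete h (p ∘ (false ∷_)) c pc =
  ∨-zeroʳ (anyVec h (p ∘ (true ∷_)))

anyVec-true⇔ : ∀ h p → anyVec h p ≡ true ⇔ (∃[ c ] p c ≡ true)
anyVec-true⇔ h p = mk⇔ (anyVec-sound h p) (λ (c , pc) → anyVec-complete h p c pc)

accepts : Outcome → Bool
accepts (terminated b) = b
accepts _              = false

certifiedTable : ∀ {n} d → d ≤ n → ℕ → List PInstr → TruthTable d
certifiedTable d d≤n h P =
  truthTable d (λ e → anyVec h (λ c → accepts (exec (padRight d≤n false e Vec.++ c) P initState)))

candidateTables : ∀ {n} d → d ≤ n → (H M L : ℕ) → List (TruthTable d)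
candidateTables d d≤n H M L =
  cartesianProductWith (certifiedTable d d≤n) (upTo (suc H)) (words (instructions M L) L)

length-candidateTables : ∀ {n} d (d≤n : d ≤ n) H M L →
  length (candidateTables d d≤n H M L) ≡ suc H * length (instructions M L) ^ L
length-candidateTables d d≤n H M L = begin
  length (candidateTables d d≤n H M L)
    ≡⟨ length-cartesianProductWith (certifiedTable d d≤n) (upTo (suc H)) (words (instructions M L) L) ⟩
  length (upTo (suc H)) * length (words (instructions M L) L)
    ≡⟨ cong₂ _*_ (length-upTo (suc H)) (length-words (instructions M L) L) ⟩
  suc H * length (instructions M L) ^ L ∎
  where open ≡-Reasoning

certified-∈-candidateTables :
  ∀ {n d h H M L} (d≤n : d ≤ n) (f : Vec Bool n → Bool) (g : Vec Bool (n + h) → Bool) (X : ISbr) →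
  (∀ w → f w ≡ true ⇔ (∃[ c ] g (w Vec.++ c) ≡ true)) →
  Computes X g → List⁺.length X ≤ L → n + h ≤ M → h ≤ H →
  truthTable d (f ∘ padRight d≤n false) ∈ candidateTables d d≤n H M L
certified-∈-candidateTables {d = d} {h} {H} {M} {L} d≤n f g X f⇔g X-computes |X|≤L n+h≤M h≤H
  with canonicalise M L (toList X) n+h≤M |X|≤L
... | P , P∈ , P≈X =
  subst (_∈ candidateTables d d≤n H M L) (truthTable-cong d certified≗f)
        (∈-cartesianProductWith⁺ (certifiedTable d d≤n) (∈-upTo⁺ (s≤s h≤H)) P∈)
  where
  certified≗f : ∀ e → anyVec h (λ c → accepts (exec (padRight d≤n false e Vec.++ c) P initState))
                    ≡ f (padRight d≤n false e)
  certified≗f e = trans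
    (anyVec-cong h (λ c → cong accepts (trans (P≈X _) (X-computes _))))
    (⇔→≡ (⇔-sym (f⇔g _) ⇔-∘ anyVec-true⇔ h _))

^-distribʳ-* : ∀ m n o → (m * n) ^ o ≡ m ^ o * n ^ o
^-distribʳ-* m n zero    = refl
^-distribʳ-* m n (suc o) = begin
  m * n * (m * n) ^ o      ≡⟨ cong (m * n *_) (^-distribʳ-* m n o) ⟩
  m * n * (m ^ o * n ^ o)  ≡⟨ solve 4 (λ m n x y → m :* n :* (x :* y) := m :* x :* (n :* y)) refl m n (m ^ o) (n ^ o) ⟩
  m * m ^ o * (n * n ^ o)  ∎
  where
  open ≡-Reasoning
  open +-*-Solver

m≤m*m : ∀ m → m ≤ m * m
m≤m*m zero    = z≤n
m≤m*m (suc m) = m≤m*n (suc m) (suc m)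

m≤m^[1+n] : ∀ m n → 1 ≤ m → m ≤ m ^ suc n
m≤m^[1+n] (suc m) n _ = ≤-trans (≤-reflexive (sym (*-identityʳ (suc m)))) (*-monoʳ-≤ (suc m) (m^n>0 (suc m) n))

[n+x]^k≤ : ∀ k {n x a} → 1 ≤ n → x ≤ a * n ^ k → (n + x) ^ k ≤ suc a ^ k * n ^ (k * k)
[n+x]^k≤ zero    _   _      = ≤-refl
[n+x]^k≤ (suc k) {n} {x} {a} 1≤n x≤an^k = begin
  (n + x) ^ suc k                      ≤⟨ ^-monoˡ-≤ (suc k) (+-mono-≤ (m≤m^[1+n] n k 1≤n) x≤an^k) ⟩
  (suc a * n ^ suc k) ^ suc k          ≡⟨ ^-distribʳ-* (suc a) (n ^ suc k) (suc k) ⟩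
  suc a ^ suc k * (n ^ suc k) ^ suc k  ≡⟨ cong (suc a ^ suc k *_) (^-*-assoc n (suc k) (suc k)) ⟩
  suc a ^ suc k * n ^ (suc k * suc k)  ∎
  where open ≤-Reasoning

n<2^n : ∀ n → n < 2 ^ n
n<2^n zero    = s≤s z≤n
n<2^n (suc n) = begin-strict
  suc n            ≡⟨ +-comm 1 n ⟩
  n + 1            <⟨ +-mono-<-≤ (n<2^n n) (m^n>0 2 n) ⟩
  2 ^ n + 2 ^ n    ≡⟨ cong (2 ^ n +_) (+-identityʳ (2 ^ n)) ⟨
  2 ^ suc n        ∎
  where open ≤-Reasoning

[4+s]²≤2^[4+s] : ∀ s → (4 + s) * (4 + s) ≤ 2 ^ (4 + s)
[4+s]²≤2^[4+s] zero    = ≤-refl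
[4+s]²≤2^[4+s] (suc s) = begin
  (5 + s) * (5 + s)                      ≡⟨ solve 1 (λ s → (con 5 :+ s) :* (con 5 :+ s) := (con 4 :+ s) :* (con 4 :+ s) :+ (con 9 :+ con 2 :* s)) refl s ⟩
  (4 + s) * (4 + s) + (9 + 2 * s)        ≤⟨ +-monoʳ-≤ ((4 + s) * (4 + s)) 9+2s≤ ⟩
  (4 + s) * (4 + s) + (4 + s) * (4 + s)  ≤⟨ +-mono-≤ ([4+s]²≤2^[4+s] s) ([4+s]²≤2^[4+s] s) ⟩
  2 ^ (4 + s) + 2 ^ (4 + s)              ≡⟨ cong (2 ^ (4 + s) +_) (+-identityʳ _) ⟨
  2 ^ (5 + s)                            ∎
  where
  open ≤-Reasoning
  open +-*-Solver
  9+2s≤ : 9 + 2 * s ≤ (4 + s) * (4 + s)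
  9+2s≤ = begin
    9 + 2 * s                   ≤⟨ m≤m+n (9 + 2 * s) (7 + 2 * s) ⟩
    (9 + 2 * s) + (7 + 2 * s)   ≡⟨ solve 1 (λ s → (con 9 :+ con 2 :* s) :+ (con 7 :+ con 2 :* s) := con 4 :* (con 4 :+ s)) refl s ⟩
    4 * (4 + s)                 ≤⟨ *-monoˡ-≤ (4 + s) (m≤m+n 4 s) ⟩
    (4 + s) * (4 + s)           ∎

large-power : ∀ B c → ∃[ t ] (B ≤ 2 ^ t × 2 * (t * c) < 2 ^ t)
large-power B c = t , ≤-trans B≤t (<⇒≤ (n<2^n t)) , 2tc<2^t
  where
  t : ℕ
  t = 4 + (2 * c + B)
  B≤t : B ≤ t
  B≤t = m≤n⇒m≤o+n 4 (m≤n+m B (2 * c))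
  2tc<2^t : 2 * (t * c) < 2 ^ t
  2tc<2^t = begin-strict
    2 * (t * c)  ≡⟨ solve 2 (λ t c → con 2 :* (t :* c) := con 2 :* c :* t) refl t c ⟩
    2 * c * t    <⟨ *-monoˡ-< t (s≤s (m≤n⇒m≤o+n 3 (m≤m+n (2 * c) B))) ⟩
    t * t        ≤⟨ [4+s]²≤2^[4+s] (2 * c + B) ⟩
    2 ^ t        ∎
    where
    open ≤-Reasoning
    open +-*-Solver

-- The diagonal family

module Diagonal (k : ℕ) where

  c : ℕ
  c = 2 + k * k

  -- Only powers of two n = 2 ^ t get a nontrivial table, on D n = t * c bits, so that 2 ^ D n ≤ n ^ c.
  D : ℕ → ℕ
  D n with 2 ^ ⌊log₂ n ⌋ ≟ n
  ... | yes _ = (⌊log₂ n ⌋ * c) ⊓ n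
  ... | no  _ = 0

  D≤n : ∀ n → D n ≤ n
  D≤n n with 2 ^ ⌊log₂ n ⌋ ≟ n
  ... | yes _ = m⊓n≤n _ n
  ... | no  _ = z≤n

  2^D≤n^c : ∀ n → 1 ≤ n → 2 ^ D n ≤ n ^ c
  2^D≤n^c n@(suc _) _ with 2 ^ ⌊log₂ n ⌋ ≟ n
  ... | yes 2^log≡n = begin
    2 ^ ((⌊log₂ n ⌋ * c) ⊓ n)  ≤⟨ ^-monoʳ-≤ 2 (m⊓n≤m (⌊log₂ n ⌋ * c) n) ⟩
    2 ^ (⌊log₂ n ⌋ * c)        ≡⟨ ^-*-assoc 2 ⌊log₂ n ⌋ c ⟨
    (2 ^ ⌊log₂ n ⌋) ^ c        ≡⟨ cong (_^ c) 2^log≡n ⟩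
    n ^ c                      ∎
    where open ≤-Reasoning
  ... | no  _ = m^n>0 n c

  D[2^t] : ∀ t → t * c ≤ 2 ^ t → D (2 ^ t) ≡ t * c
  D[2^t] t tc≤2^t with 2 ^ ⌊log₂ 2 ^ t ⌋ ≟ 2 ^ t
  ... | yes _ rewrite ⌊log₂[2^n]⌋≡n t = m≤n⇒m⊓n≡m tc≤2^t
  ... | no  2^log≢2^t = contradiction (cong (2 ^_) (⌊log₂[2^n]⌋≡n t)) 2^log≢2^t

  -- A witness of membership in N[IS_br/O(n ^ k)] eventually has certificates of length at most H n,
  -- programs of length at most L n, and at most M n inputs.
  H M L : ℕ → ℕ
  H n = n ^ suc k
  M n = n + H n
  L n = n ^ suc (k * k)

  candidates : (n : ℕ) → List (TruthTable (D n))
  candidates n = candidateTables (D n) (D≤n n) (H n) (M n) (L n)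

  table : (n : ℕ) → TruthTable (D n)
  table n = missing (2 ^ D n) (candidates n)

  diagonal : Family
  diagonal n w = evalTable (D n) (table n) (truncate (D≤n n) w)

  diagonal∈ISbr/O : ISbr/O (λ n → n ^ c) diagonal
  diagonal∈ISbr/O = (λ n → List⁺.length (tree n)) , (5 , 1 , length-tree) , λ n → tree n , computes n , ≤-refl
    where
    tree : ℕ → ISbr
    tree n = decisionTree 0 (D n) (table n)

    computes : ∀ n → Computes (tree n) (diagonal n)
    computes n w = trans (cong (λ xs → exec w xs initState) (sym (++-identityʳ (toList (tree n)))))
      (decisionTree-correct w 0 (D n) (table n) _ [] initState (storedAt-truncate (D≤n n) w))

    length-tree : ∀ n → 1 ≤ n → List⁺.length (tree n) ≤ 5 * n ^ c
    length-tree n 1≤n = ≤-trans (m≤m+n _ 3)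
      (≤-trans (length-decisionTree 0 (D n) (table n)) (*-monoʳ-≤ 5 (2^D≤n^c n 1≤n)))

  truthTable-diagonal : ∀ n → truthTable (D n) (diagonal n ∘ padRight (D≤n n) false) ≡ table n
  truthTable-diagonal n = trans
    (truthTable-cong (D n) (cong (evalTable (D n) (table n)) ∘ truncate-padRight (D≤n n) false))
    (truthTable-evalTable (D n) (table n))

  candidates-few : ∀ t → 32 ≤ 2 ^ t → 2 * (t * c) < 2 ^ t → length (candidates (2 ^ t)) < 2 ^ (2 ^ D (2 ^ t))
  candidates-few t 32≤n 2tc<n = begin-strict
    length (candidates n)      ≡⟨ length-candidateTables (D n) (D≤n n) (H n) (M n) Λ ⟩
    suc (H n) * A ^ Λ          ≤⟨ *-monoˡ-≤ (A ^ Λ) (≤-trans (s≤s (m≤n+m (H n) n)) (M<length-instructions (M n) Λ)) ⟩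
    A ^ suc Λ                  ≤⟨ ^-monoˡ-≤ (suc Λ) A≤nΛ ⟩
    (n * Λ) ^ suc Λ            ≡⟨ cong (_^ suc Λ) nΛ≡2^tc ⟩
    (2 ^ (t * c)) ^ suc Λ      ≡⟨ ^-*-assoc 2 (t * c) (suc Λ) ⟩
    2 ^ (t * c * suc Λ)        <⟨ ^-monoʳ-< 2 (s≤s (s≤s z≤n)) tc[Λ+1]<nΛ ⟩
    2 ^ (n * Λ)                ≡⟨ cong (2 ^_) (trans nΛ≡2^tc (cong (2 ^_) (sym (D[2^t] t tc≤n)))) ⟩
    2 ^ (2 ^ D n)              ∎
    where
    open ≤-Reasoning
    open +-*-Solver
    n Λ A : ℕ
    n = 2 ^ t
    Λ = L n
    A = length (instructions (M n) Λ)

    1≤n : 1 ≤ n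
    1≤n = m^n>0 2 t
    1≤Λ : 1 ≤ Λ
    1≤Λ = m^n>0 n ⦃ >-nonZero 1≤n ⦄ (suc (k * k))

    tc≤n : t * c ≤ n
    tc≤n = ≤-trans (m≤m+n (t * c) (t * c + 0)) (<⇒≤ 2tc<n)

    -- n * Λ is n ^ c by the definition of _^_.
    nΛ≡2^tc : n * Λ ≡ 2 ^ (t * c)
    nΛ≡2^tc = ^-*-assoc 2 t c

    A≤nΛ : A ≤ n * Λ
    A≤nΛ = ≤-trans (length-instructions-≤ (M n) Λ M≤2Λ 1≤Λ) (*-monoˡ-≤ Λ (≤-trans (m≤m+n 28 4) 32≤n))
      where
      M≤2Λ : M n ≤ Λ + Λ
      M≤2Λ = +-mono-≤ (m≤m^[1+n] n (k * k) 1≤n) (^-monoʳ-≤ n ⦃ >-nonZero 1≤n ⦄ (s≤s (m≤m*m k)))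

    tc[Λ+1]<nΛ : t * c * suc Λ < n * Λ
    tc[Λ+1]<nΛ = begin-strict
      t * c * suc Λ       ≤⟨ *-monoʳ-≤ (t * c) (+-monoˡ-≤ Λ 1≤Λ) ⟩
      t * c * (Λ + Λ)     ≡⟨ solve 2 (λ x y → x :* (y :+ y) := con 2 :* x :* y) refl (t * c) Λ ⟩
      2 * (t * c) * Λ     <⟨ *-monoˡ-< Λ ⦃ >-nonZero 1≤Λ ⦄ 2tc<n ⟩
      n * Λ               ∎

  table∈candidates : ∀ n {h} (g : Vec Bool (n + h) → Bool) (X : ISbr) →
    (∀ w → diagonal n w ≡ true ⇔ (∃[ c ] g (w Vec.++ c) ≡ true)) →
    Computes X g → List⁺.length X ≤ L n → h ≤ H n → table n ∈ candidates n
  table∈candidates n {h} g X diagonal⇔g X-computes |X|≤L h≤H =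
    subst (_∈ candidates n) (truthTable-diagonal n)
      (certified-∈-candidateTables {H = H n} {M n} {L n} (D≤n n) (diagonal n) g X diagonal⇔g
        X-computes |X|≤L (+-monoʳ-≤ n h≤H) h≤H)

  diagonal∉N[ISbr/O] : ¬ N[ISbr/O] (λ n → n ^ k) diagonal
  diagonal∉N[ISbr/O] (h , _ , (c₁ , n₁ , h≤) , g , (ℓ , (c₂ , n₂ , ℓ≤) , programs) , diagonal⇔g) =
    refuteAt (large-power (c₁ + (n₁ + (n₂ + (c₂ * suc c₁ ^ k + 32)))) c)
    where
    refuteAt : ∃[ t ] (c₁ + (n₁ + (n₂ + (c₂ * suc c₁ ^ k + 32))) ≤ 2 ^ t × 2 * (t * c) < 2 ^ t) → ⊥
    refuteAt (t , B≤n , 2tc<n) = missing-∉ (2 ^ D n) (candidates n) (candidates-few t 32≤n 2tc<n)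
      (table∈candidates n (g (n + h n)) (proj₁ program) (diagonal⇔g n) (proj₁ (proj₂ program)) |program|≤L h≤H)
      where
      n : ℕ
      n = 2 ^ t

      c₁≤n : c₁ ≤ n
      c₁≤n = ≤-trans (m≤m+n c₁ _) B≤n
      n₁≤n : n₁ ≤ n
      n₁≤n = ≤-trans (m≤n⇒m≤o+n c₁ (m≤m+n n₁ _)) B≤n
      n₂≤n : n₂ ≤ n
      n₂≤n = ≤-trans (m≤n⇒m≤o+n c₁ (m≤n⇒m≤o+n n₁ (m≤m+n n₂ _))) B≤n
      c₂[1+c₁]^k≤n : c₂ * suc c₁ ^ k ≤ n
      c₂[1+c₁]^k≤n = ≤-trans (m≤n⇒m≤o+n c₁ (m≤n⇒m≤o+n n₁ (m≤n⇒m≤o+n n₂ (m≤m+n _ 32)))) B≤n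
      32≤n : 32 ≤ n
      32≤n = ≤-trans (m≤n⇒m≤o+n c₁ (m≤n⇒m≤o+n n₁ (m≤n⇒m≤o+n n₂ (m≤n+m 32 _)))) B≤n

      h≤H : h n ≤ H n
      h≤H = ≤-trans (h≤ n n₁≤n) (*-monoˡ-≤ (n ^ k) c₁≤n)

      program : ∃[ X ] (Computes X (g (n + h n)) × List⁺.length X ≤ ℓ (n + h n))
      program = programs (n + h n)

      |program|≤L : List⁺.length (proj₁ program) ≤ L n
      |program|≤L = begin
        List⁺.length (proj₁ program)    ≤⟨ proj₂ (proj₂ program) ⟩
        ℓ (n + h n)                     ≤⟨ ℓ≤ (n + h n) (≤-trans n₂≤n (m≤m+n n (h n))) ⟩
        c₂ * (n + h n) ^ k              ≤⟨ *-monoʳ-≤ c₂ ([n+x]^k≤ k (m^n>0 2 t) (h≤ n n₁≤n)) ⟩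
        c₂ * (suc c₁ ^ k * n ^ (k * k)) ≡⟨ *-assoc c₂ _ _ ⟨
        c₂ * suc c₁ ^ k * n ^ (k * k)   ≤⟨ *-monoˡ-≤ (n ^ (k * k)) c₂[1+c₁]^k≤n ⟩
        L n                             ∎
        where open ≤-Reasoning

  diagonal∈N[ISbr/O] : N[ISbr/O] (λ n → n ^ (k * k + 3)) diagonal
  diagonal∈N[ISbr/O] = ISbr/O⊆N[ISbr/O] (ISbr/O-mono (BigO-^ c≤k*k+3) diagonal∈ISbr/O)
    where
    c≤k*k+3 : c ≤ k * k + 3
    c≤k*k+3 = ≤-trans (≤-reflexive (+-comm 2 (k * k))) (+-monoʳ-≤ (k * k) (n≤1+n 2))

theorem10 : (k : ℕ) →
    ((f : Family) → N[ISbr/O] (λ n → n ^ k) f → N[ISbr/O] (λ n → n ^ (k * k + 3)) f)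
    × (∃[ f ] (N[ISbr/O] (λ n → n ^ (k * k + 3)) f × ¬ N[ISbr/O] (λ n → n ^ k) f))
theorem10 k =
  (λ _ → N[ISbr/O]-mono (BigO-^ k≤k*k+3)) ,
  (diagonal , diagonal∈N[ISbr/O] , diagonal∉N[ISbr/O])
  where
  open Diagonal k
  k≤k*k+3 : k ≤ k * k + 3
  k≤k*k+3 = ≤-trans (m≤m*m k) (m≤m+n (k * k) 3)
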